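{- Let $\mathbb C$ be an internal category in $\mathrm{Asm}$. Let $A$ be a uniform internal presheaf on $\mathbb C$ and $X:\mathbb C^{op}\to\mathrm{PER}$ an internal functor (regarded as the presheaf $c\mapsto\mathrm{el}(X(c))$). Then the precomposition map $i^{*}:(\|A\|\to X)\to(A\to X)$ in $\mathrm{PSh}(\mathbb C)$ is an isomorphism, where $i:A\to\|A\|$ is the constructor of the propositional truncation. In particular, if in addition $A$ is well-supported, then $\lambda xa.x:X\to(A\to X)$ is an isomorphism.
   Context: An assembly is a set $A$ with a non-empty set $E_A(a)\subseteq\mathbb N$ of realizers for each $a\in A$; a morphism $f:A\to B$ is a function for which some partial recursive $e$ satisfies: for all $a$ and $n\in E_A(a)$, $en$ is defined and in $E_B(f(a))$. $\mathrm{Asm}$ is a model of extensional dependent type theory (types over $\Gamma$: families of assemblies indexed by the underlying set of $\Gamma$; terms: uniformly tracked sections), with $\Pi$, $\Sigma$, identity types, unit, disjoint finite coproducts, natural numbers, and propositional truncation ($\|A\|(\gamma)=\{*\}$ if $A(\gamma)\neq\emptyset$, else $\emptyset$, with $E(*)=\bigcup_{a}E(a)$). An assembly is modest if distinct elements have disjoint realizer sets. $\mathrm{PER}$ is the assembly of partial equivalence relations on $\mathbb N$ (each realized by $0$) with $\mathrm{el}(R)=\mathbb N/R$ (classes of $\{n\mid R(n,n)\}$, each realized by its members); it classifies modest families. Internal categories, presheaves and the presheaf model $\mathrm{PSh}(\mathbb C)$ (contexts: internal presheaves; types: presheaves on categories of elements; terms: sections) are as usual, with pointwise propositional truncation. An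 assembly is uniform if $\bigcap_{a\in A}E_A(a)\neq\emptyset$; an internal presheaf $A$ is uniform if every $A(c)$ is uniform; it is well-supported if $A\to1$ is regular epi, equivalently there is a partial recursive $e$ such that for every object $c$ and $n\in E(c)$ some $a\in A(c)$ has $en$ defined and in $E_A(a)$. -}

module Defs where

open import Data.Nat using (ℕ; zero; suc; _+_; _<_)
open import Data.Product using (Σ; _×_; _,_; proj₁; proj₂; Σ-syntax)
open import Data.Unit using (⊤; tt)
open import Relation.Binary.PropositionalEquality using (_≡_; refl)
open import Relation.Binary.Structures using (IsEquivalence)

tri : ℕ → ℕ
tri zero    = zero
tri (suc n) = suc n + tri n

pair : ℕ → ℕ → ℕ
pair a b = tri (a + b) + b

data Code : Set where
  zeroC succC idC fstC sndC : Code
  pairC compC recC : Code → Code → Code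
  muC : Code → Code

-- Big-step semantics:  Eval c x y  means  ⟦c⟧(x) is defined and equals y
data Eval : Code → ℕ → ℕ → Set where
  ev-zero : ∀ {x} → Eval zeroC x 0
  ev-succ : ∀ {x} → Eval succC x (suc x)
  ev-id   : ∀ {x} → Eval idC x x
  ev-fst  : ∀ {x a b} → x ≡ pair a b → Eval fstC x a
  ev-snd  : ∀ {x a b} → x ≡ pair a b → Eval sndC x b
  ev-pair : ∀ {f g x a b} → Eval f x a → Eval g x b → Eval (pairC f g) x (pair a b)
  ev-comp : ∀ {f g x y z} → Eval g x y → Eval f y z → Eval (compC f g) x z
  -- h⟨u,0⟩ = f u ;  h⟨u,y+1⟩ = g⟨u,⟨y,h⟨u,y⟩⟩⟩
  ev-rec0 : ∀ {f g x u z} → x ≡ pair u 0 → Eval f u z → Eval (recC f g) x z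
  ev-recS : ∀ {f g x u y w z} → x ≡ pair u (suc y) →
            Eval (recC f g) (pair u y) w → Eval g (pair u (pair y w)) z →
            Eval (recC f g) x z
  ev-mu   : ∀ {f x y} → (∀ k → k < y → Σ ℕ λ v → Eval f (pair x k) (suc v)) →
            Eval f (pair x y) 0 → Eval (muC f) x y

encode : Code → ℕ
encode zeroC       = pair 0 0
encode succC       = pair 1 0
encode idC         = pair 2 0
encode fstC        = pair 3 0
encode sndC        = pair 4 0
encode (pairC f g) = pair 5 (pair (encode f) (encode g))
encode (compC f g) = pair 6 (pair (encode f) (encode g))
encode (recC f g)  = pair 7 (pair (encode f) (encode g))
encode (muC f)     = pair 8 (encode f)

-- Kleene application:  e · n ≃ m  ("en is defined and equals m");
-- numbers that are not codes index the nowhere-defined function.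
_·_≃_ : ℕ → ℕ → ℕ → Set
e · n ≃ m = Σ Code λ c → encode c ≡ e × Eval c n m

record Asm : Set₁ where
  field
    Carrier : Set
    _≈_     : Carrier → Carrier → Set
    isEquiv : IsEquivalence _≈_
    E       : Carrier → ℕ → Set
    E-resp  : ∀ {a b n} → a ≈ b → E a n → E b n
    E-inh   : ∀ a → Σ ℕ (E a)

open Asm public

∣_∣ : Asm → Set
∣ A ∣ = Carrier A

Uniform : Asm → Set
Uniform A = Σ ℕ λ n → ∀ (a : ∣ A ∣) → E A a n

record PER : Set₁ where
  field
    R     : ℕ → ℕ → Set
    R-sym : ∀ {m n} → R m n → R n m
    R-tr  : ∀ {k m n} → R k m → R m n → R k n

open PER public

-- el(R) = ℕ/R: classes of {n | R n n}, presented by representatives;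
-- a class is realized by its members.
el : PER → Asm
el P = record
  { Carrier = Σ ℕ λ n → R P n n
  ; _≈_     = λ x y → R P (proj₁ x) (proj₁ y)
  ; isEquiv = record { refl = λ {x} → proj₂ x
                     ; sym = R-sym P
                     ; trans = R-tr P }
  ; E       = λ x m → R P (proj₁ x) m
  ; E-resp  = λ xy xm → R-tr P (R-sym P xy) xm
  ; E-inh   = λ x → proj₁ x , proj₂ x
  }

-- Internal categories in Asm
-- (C₁ presented as the family Hom d c over C₀ × C₀; a morphism f : d → c
--  is realized, as an element of C₁, by ⟨⟨n_d , n_c⟩ , m⟩.)

module _ {Ob : Set} (EOb : Ob → ℕ → Set) where

  TotReal : (F : Ob → Asm) → (c : Ob) → ∣ F c ∣ → ℕ → Set
  TotReal F c x s = Σ ℕ λ n → Σ ℕ λ m → s ≡ pair n m × EOb c n × E (F c) x m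

  HomReal : (Hom : Ob → Ob → Asm) → (d c : Ob) → ∣ Hom d c ∣ → ℕ → Set
  HomReal Hom d c f r = Σ ℕ λ nd → Σ ℕ λ nc → Σ ℕ λ m →
    r ≡ pair (pair nd nc) m × EOb d nd × EOb c nc × E (Hom d c) f m

record IntCat : Set₁ where
  field
    Ob      : Set
    EOb     : Ob → ℕ → Set
    EOb-inh : ∀ c → Σ ℕ (EOb c)
    Hom     : Ob → Ob → Asm                      -- Hom d c : morphisms d → c
    idm     : ∀ c → ∣ Hom c c ∣
    _∘_     : ∀ {b c d} → ∣ Hom c d ∣ → ∣ Hom b c ∣ → ∣ Hom b d ∣
    ∘-cong  : ∀ {b c d} {f f' : ∣ Hom c d ∣} {g g' : ∣ Hom b c ∣} →
              _≈_ (Hom c d) f f' → _≈_ (Hom b c) g g' → _≈_ (Hom b d) (f ∘ g) (f' ∘ g')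
    idˡ     : ∀ {c d} (f : ∣ Hom c d ∣) → _≈_ (Hom c d) (idm d ∘ f) f
    idʳ     : ∀ {c d} (f : ∣ Hom c d ∣) → _≈_ (Hom c d) (f ∘ idm c) f
    assoc   : ∀ {a b c d} (f : ∣ Hom c d ∣) (g : ∣ Hom b c ∣) (h : ∣ Hom a b ∣) →
              _≈_ (Hom a d) ((f ∘ g) ∘ h) (f ∘ (g ∘ h))
    idm-tr  : Σ Code λ t → ∀ c n → EOb c n →
              Σ ℕ λ m → Eval t n m × HomReal EOb Hom c c (idm c) m
    ∘-tr    : Σ Code λ t → ∀ {b c d} (f : ∣ Hom c d ∣) (g : ∣ Hom b c ∣) r s →
              HomReal EOb Hom c d f r → HomReal EOb Hom b c g s →
              Σ ℕ λ m → Eval t (pair r s) m × HomReal EOb Hom b d (f ∘ g) m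

module _ (C : IntCat) where
  open IntCat C

  record PShOn (F : Ob → Asm) : Set where
    field
      act      : ∀ {d c} → ∣ Hom d c ∣ → ∣ F c ∣ → ∣ F d ∣
      act-cong : ∀ {d c} {f f' : ∣ Hom d c ∣} {x x' : ∣ F c ∣} →
                 _≈_ (Hom d c) f f' → _≈_ (F c) x x' → _≈_ (F d) (act f x) (act f' x')
      act-id   : ∀ {c} (x : ∣ F c ∣) → _≈_ (F c) (act (idm c) x) x
      act-∘    : ∀ {b c d} (f : ∣ Hom c d ∣) (g : ∣ Hom b c ∣) (x : ∣ F d ∣) →
                 _≈_ (F b) (act (f ∘ g) x) (act g (act f x))
      act-tr   : Σ Code λ t → ∀ {d c} (f : ∣ Hom d c ∣) (x : ∣ F c ∣) r s →
                 HomReal EOb Hom d c f r → TotReal EOb F c x s →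
                 Σ ℕ λ m → Eval t (pair r s) m × TotReal EOb F d (act f x) m

  record PSh : Set₁ where
    field
      Fib  : Ob → Asm
      isPSh : PShOn Fib

  open PSh public

  UniformPSh : PSh → Set
  UniformPSh A = ∀ c → Uniform (Fib A c)

  WellSupported : PSh → Set
  WellSupported A = Σ Code λ e → ∀ c n → EOb c n →
    Σ ∣ Fib A c ∣ λ a → Σ ℕ λ m → Eval e n m × E (Fib A c) a m

  record PERFunctor : Set₁ where
    field
      X₀    : Ob → PER
      X-psh : PShOn (λ c → el (X₀ c))

  asPSh : PERFunctor → PSh
  asPSh X = record { Fib = λ c → el (PERFunctor.X₀ X c) ; isPSh = PERFunctor.X-psh X }

  -- propositional truncation (pointwise):  ‖A‖(c) = {*} if A(c) ≠ ∅,
  -- presented as A(c) modulo the total relation; E(*) = ⋃_a E(a).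
  TruncAsm : Asm → Asm
  TruncAsm A = record
    { Carrier = ∣ A ∣
    ; _≈_ = λ _ _ → ⊤
    ; isEquiv = record { refl = tt ; sym = λ _ → tt ; trans = λ _ _ → tt }
    ; E = λ _ n → Σ ∣ A ∣ λ a → E A a n
    ; E-resp = λ _ p → p
    ; E-inh = λ a → proj₁ (E-inh A a) , a , proj₂ (E-inh A a)
    }

  Trunc : PSh → PSh
  Trunc A = record
    { Fib = λ c → TruncAsm (Fib A c)
    ; isPSh = record
      { act = PShOn.act (isPSh A)
      ; act-cong = λ _ _ → tt
      ; act-id = λ _ → tt
      ; act-∘ = λ _ _ _ → tt
      ; act-tr = proj₁ tr , λ f x r s hr ts → go f x r s hr ts
      }
    }
    where
    tr = PShOn.act-tr (isPSh A)
    go : ∀ {d c} (f : ∣ Hom d c ∣) (x : ∣ Fib A c ∣) r s →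
         HomReal EOb Hom d c f r → TotReal EOb (λ c → TruncAsm (Fib A c)) c x s →
         Σ ℕ λ m → Eval (proj₁ tr) (pair r s) m ×
                   TotReal EOb (λ c → TruncAsm (Fib A c)) d (PShOn.act (isPSh A) f x) m
    go f x r s hr (n , m , eq , en , (a , ea)) with proj₂ tr f a r s hr (n , m , eq , en , ea)
    ... | (k , ev , (n' , m' , eq' , en' , ea')) =
          k , ev , (n' , m' , eq' , en' , (PShOn.act (isPSh A) f a , ea'))

  -- the exponential (P → Q) in PSh(C), fibre at c: natural, extensional
  -- families s_f : P(d) → Q(d) for f : d → c, tracked uniformly by some
  -- e ∈ ℕ:  e·⟨r,t⟩ ∈ E(s_f(a)) whenever r realizes f ∈ C₁ and t ∈ E(a).
  module _ (P Q : PSh) where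
    private
      actP = PShOn.act (isPSh P)
      actQ = PShOn.act (isPSh Q)

    Tracks : (c : Ob) → (∀ {d} → ∣ Hom d c ∣ → ∣ Fib P d ∣ → ∣ Fib Q d ∣) → ℕ → Set
    Tracks c s e = ∀ {d} (f : ∣ Hom d c ∣) (a : ∣ Fib P d ∣) r t →
      HomReal EOb Hom d c f r → E (Fib P d) a t →
      Σ ℕ λ m → e · pair r t ≃ m × E (Fib Q d) (s f a) m

    record ExpEl (c : Ob) : Set where
      field
        fun  : ∀ {d} → ∣ Hom d c ∣ → ∣ Fib P d ∣ → ∣ Fib Q d ∣
        cong : ∀ {d} {f f' : ∣ Hom d c ∣} {a a' : ∣ Fib P d ∣} →
               _≈_ (Hom d c) f f' → _≈_ (Fib P d) a a' → _≈_ (Fib Q d) (fun f a) (fun f' a')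
        nat  : ∀ {b d} (f : ∣ Hom d c ∣) (g : ∣ Hom b d ∣) (a : ∣ Fib P d ∣) →
               _≈_ (Fib Q b) (fun (f ∘ g) (actP g a)) (actQ g (fun f a))
        realizer : Σ ℕ (Tracks c fun)

    Exp : Ob → Asm
    Exp c = record
      { Carrier = ExpEl c
      ; _≈_ = λ s s' → ∀ {d} (f : ∣ Hom d c ∣) (a : ∣ Fib P d ∣) →
                _≈_ (Fib Q d) (ExpEl.fun s f a) (ExpEl.fun s' f a)
      ; isEquiv = record
        { refl = λ {s} f a → IsEquivalence.refl (isEquiv (Fib Q _))
        ; sym = λ p f a → IsEquivalence.sym (isEquiv (Fib Q _)) (p f a)
        ; trans = λ p q f a → IsEquivalence.trans (isEquiv (Fib Q _)) (p f a) (q f a)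
        }
      ; E = λ s e → Tracks c (ExpEl.fun s) e
      ; E-resp = λ {s} {s'} p tr f a r t hr ta →
          let (m , ap , em) = tr f a r t hr ta in
          m , ap , E-resp (Fib Q _) (p f a) em
      ; E-inh = λ s → ExpEl.realizer s
      }

  -- isomorphism in PSh(C) for a fibrewise map φ: an inverse family ψ,
  -- extensional and uniformly tracked, with both composites the identity.
  -- (Naturality of ψ follows from that of φ.)
  IsIso : (F G : Ob → Asm) → (∀ c → ∣ F c ∣ → ∣ G c ∣) → Set
  IsIso F G φ = Σ (∀ c → ∣ G c ∣ → ∣ F c ∣) λ ψ →
      (∀ c {y y' : ∣ G c ∣} → _≈_ (G c) y y' → _≈_ (F c) (ψ c y) (ψ c y'))
    × (Σ Code λ t → ∀ c (y : ∣ G c ∣) s → TotReal EOb G c y s →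
         Σ ℕ λ m → Eval t s m × TotReal EOb F c (ψ c y) m)
    × (∀ c (x : ∣ F c ∣) → _≈_ (F c) (ψ c (φ c x)) x)
    × (∀ c (y : ∣ G c ∣) → _≈_ (G c) (φ c (ψ c y)) y)

  -- i : A → ‖A‖ is the identity on representatives; precomposition i*
  istar : (A Q : PSh) → ∀ c → ExpEl (Trunc A) Q c → ExpEl A Q c
  istar A Q c s = record
    { fun = λ f a → ExpEl.fun s f a
    ; cong = λ p _ → ExpEl.cong s p tt
    ; nat = λ f g a → ExpEl.nat s f g a
    ; realizer = proj₁ (ExpEl.realizer s) ,
        λ f a r t hr ta → proj₂ (ExpEl.realizer s) f a r t hr (a , ta)
    }

constC : ℕ → Code
constC zero    = zeroC
constC (suc k) = compC succC (constC k)

constC-eval : ∀ k x → Eval (constC k) x k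
constC-eval zero    x = ev-zero
constC-eval (suc k) x = ev-comp (constC-eval k x) ev-succ

module _ (C : IntCat) where
  open IntCat C

  const-exp : (A Q : PSh C) → ∀ c → ∣ Fib Q c ∣ → ExpEl C A Q c
  const-exp A Q c x = record
    { fun = λ f a → actQ f x
    ; cong = λ p _ → PShOn.act-cong (isPSh Q) p (IsEquivalence.refl (isEquiv (Fib Q c)))
    ; nat = λ f g a → PShOn.act-∘ (isPSh Q) f g x
    ; realizer = encode code , trk
    }
    where
    actQ = PShOn.act (isPSh Q)
    tQ = PShOn.act-tr (isPSh Q)
    nc = proj₁ (EOb-inh c)
    mx = proj₁ (E-inh (Fib Q c) x)
    code = compC sndC (compC (proj₁ tQ) (pairC fstC (constC (pair nc mx))))
    trk : Tracks C A Q c (λ f a → actQ f x) (encode code)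
    trk f a r t hr ta = fin (proj₂ tQ f x r (pair nc mx) hr
             (nc , mx , refl , proj₂ (EOb-inh c) , proj₂ (E-inh (Fib Q c) x)))
      where
      fin : Σ ℕ (λ m → Eval (proj₁ tQ) (pair r (pair nc mx)) m × TotReal EOb (Fib Q) _ (actQ f x) m) →
            Σ ℕ λ m → encode code · pair r t ≃ m × E (Fib Q _) (actQ f x) m
      fin (v , ev , (n' , m' , eq , _ , em)) =
        m' , (code , refl ,
              ev-comp {y = v} (ev-comp {y = pair r (pair nc mx)} (ev-pair (ev-fst {a = r} {b = t} refl) (constC-eval (pair nc mx) (pair r t))) ev) (ev-snd {a = n'} {b = m'} eq)) , em

{-# OPTIONS --safe #-}
module Submission where

-- If every A(d) has a common realizer n, then for s : A → X the values s_f(a) and s_f(a′) are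
-- realized by the same number e·⟨r, n⟩; since distinct elements of a PER quotient have disjoint
-- realizer sets, s_f is constant and s factors through ‖A‖.  If A is moreover well-supported it
-- has a point a₀ at every stage, and s ↦ s_id(a₀) inverts λxa.x.
-- Single-valuedness of Kleene application, and tracking s ↦ s_id(a₀) (which must apply a
-- realizer received as input), both rest on a universal code: one step of an abstract machine
-- for Eval is compiled into a code, iterated by primitive recursion, and stopped by μ at the
-- first final state.

open import Defs
open import Data.Empty using (⊥)
open import Data.List using (List; []; _∷_)
open import Data.Nat using (ℕ; zero; suc; pred; _+_; _∸_; _≤_; _<_; z≤n; s≤s)
open import Data.Nat.GeneralisedArithmetic using (fold; fold-+)
open import Data.Nat.Induction using (<-rec)
open import Data.Nat.Properties
open import Data.Product using (Σ; ∃; ∃₂; _×_; _,_; proj₁; proj₂)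
open import Data.Sum using (inj₁; inj₂)
open import Data.Unit using (⊤; tt)
open import Level using (0ℓ)
open import Relation.Binary.Bundles using (Setoid)
open import Relation.Binary.Definitions using (tri<; tri≈; tri>)
open import Relation.Binary.PropositionalEquality
open import Relation.Binary.Structures using (IsEquivalence)
import Relation.Binary.Reasoning.Setoid as SetoidReasoning
open import Relation.Nullary using (¬_; Dec; yes; no; contradiction)
open import Relation.Unary using (Pred; Decidable)

-- Cantor pairing

tri-mono-≤ : ∀ {m n} → m ≤ n → tri m ≤ tri n
tri-mono-≤ z≤n       = z≤n
tri-mono-≤ (s≤s m≤n) = s≤s (+-mono-≤ m≤n (tri-mono-≤ m≤n))

pair-< : ∀ a b a′ b′ → a + b < a′ + b′ → pair a b < pair a′ b′
pair-< a b a′ b′ s<s′ = begin-strict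
  tri s + b     ≤⟨ +-monoʳ-≤ (tri s) (m≤n+m b a) ⟩
  tri s + s     ≡⟨ +-comm (tri s) s ⟩
  s + tri s     <⟨ n<1+n _ ⟩
  tri (suc s)   ≤⟨ tri-mono-≤ s<s′ ⟩
  tri (a′ + b′) ≤⟨ m≤m+n _ b′ ⟩
  pair a′ b′    ∎
  where
  open ≤-Reasoning
  s : ℕ
  s = a + b

pair-injective : ∀ {a b a′ b′} → pair a b ≡ pair a′ b′ → a ≡ a′ × b ≡ b′
pair-injective {a} {b} {a′} {b′} eq with <-cmp (a + b) (a′ + b′)
... | tri< lt _ _ = contradiction eq (<⇒≢ (pair-< a b a′ b′ lt))
... | tri> _ _ gt = contradiction (sym eq) (<⇒≢ (pair-< a′ b′ a b gt))
... | tri≈ _ s≡s′ _ = a≡a′ , b≡b′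
  where
  b≡b′ : b ≡ b′
  b≡b′ = +-cancelˡ-≡ (tri (a + b)) b b′ (trans eq (cong (λ s → tri s + b′) (sym s≡s′)))
  a≡a′ : a ≡ a′
  a≡a′ = +-cancelʳ-≡ b a a′ (trans s≡s′ (cong (a′ +_) (sym b≡b′)))

suc-pair-zero : ∀ b → suc (pair 0 b) ≡ pair (suc b) 0
suc-pair-zero b rewrite +-identityʳ b | +-identityʳ (b + tri b) = cong suc (+-comm (tri b) b)

suc-pair-suc : ∀ a b → suc (pair (suc a) b) ≡ pair a (suc b)
suc-pair-suc a b rewrite +-suc a b = sym (+-suc (tri (suc (a + b))) b)

unpair : ∀ x → ∃₂ λ a b → x ≡ pair a b
unpair zero = 0 , 0 , refl
unpair (suc x) with unpair x
... | zero  , b , x≡ = suc b , 0 , trans (cong suc x≡) (suc-pair-zero b)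
... | suc a , b , x≡ = a , suc b , trans (cong suc x≡) (suc-pair-suc a b)

π₁ π₂ : ℕ → ℕ
π₁ x = proj₁ (unpair x)
π₂ x = proj₁ (proj₂ (unpair x))

pair-π : ∀ x → x ≡ pair (π₁ x) (π₂ x)
pair-π x = proj₂ (proj₂ (unpair x))

π-pair : ∀ a b → π₁ (pair a b) ≡ a × π₂ (pair a b) ≡ b
π-pair a b = pair-injective {π₁ (pair a b)} {π₂ (pair a b)} {a} {b} (sym (pair-π (pair a b)))

-- A language of total functions compiled to codes

fst-pair : ∀ a b → Eval fstC (pair a b) a
fst-pair a b = ev-fst {a = a} {b = b} refl

snd-pair : ∀ a b → Eval sndC (pair a b) b
snd-pair a b = ev-snd {a = a} {b = b} refl

rec-zero : ∀ {f g u z} → Eval f u z → Eval (recC f g) (pair u 0) z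
rec-zero {u = u} = ev-rec0 {u = u} refl

rec-suc : ∀ {f g u y w z} → Eval (recC f g) (pair u y) w → Eval g (pair u (pair y w)) z →
          Eval (recC f g) (pair u (suc y)) z
rec-suc {u = u} {y} = ev-recS {u = u} {y = y} refl

data Tree : Set where
  leaf : ℕ → Tree
  node : Tree → Tree → Tree

⌊_⌋ : Tree → ℕ
⌊ leaf n   ⌋ = n
⌊ node l r ⌋ = pair ⌊ l ⌋ ⌊ r ⌋

left right : Tree → Tree
left  (leaf x)   = leaf (π₁ x)
left  (node l r) = l
right (leaf x)   = leaf (π₂ x)
right (node l r) = r

left-correct : ∀ t → Eval fstC ⌊ t ⌋ ⌊ left t ⌋
left-correct (leaf x)   = ev-fst {a = π₁ x} {b = π₂ x} (pair-π x)
left-correct (node l r) = fst-pair ⌊ l ⌋ ⌊ r ⌋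

right-correct : ∀ t → Eval sndC ⌊ t ⌋ ⌊ right t ⌋
right-correct (leaf x)   = ev-snd {a = π₁ x} {b = π₂ x} (pair-π x)
right-correct (node l r) = snd-pair ⌊ l ⌋ ⌊ r ⌋

-- Expressions act on trees rather than numbers so that projecting out of
-- a pair built by the expression itself computes definitionally.
data Expr : Set where
  `input               : Expr
  `fst `snd `suc `pred : Expr → Expr
  `⟨_,_⟩               : Expr → Expr → Expr
  `lit                 : ℕ → Expr
  `case_of_else_       : Expr → List Expr → Expr → Expr

⟦_⟧ : Expr → Tree → Tree
select : List Expr → Expr → ℕ → Tree → Tree

⟦ `input ⟧              t = t
⟦ `fst e ⟧              t = left (⟦ e ⟧ t)
⟦ `snd e ⟧              t = right (⟦ e ⟧ t)
⟦ `suc e ⟧              t = leaf (suc ⌊ ⟦ e ⟧ t ⌋)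
⟦ `pred e ⟧             t = leaf (pred ⌊ ⟦ e ⟧ t ⌋)
⟦ `⟨ e , e′ ⟩ ⟧         t = node (⟦ e ⟧ t) (⟦ e′ ⟧ t)
⟦ `lit n ⟧              t = leaf n
⟦ `case e of bs else d ⟧ t = select bs d ⌊ ⟦ e ⟧ t ⌋ t

select []       d k       t = ⟦ d ⟧ t
select (b ∷ bs) d zero    t = ⟦ b ⟧ t
select (b ∷ bs) d (suc k) t = select bs d k t

predRec : Code
predRec = recC zeroC (compC fstC sndC)

predRec-correct : ∀ n → Eval predRec (pair 0 n) (pred n)
predRec-correct zero    = rec-zero {u = 0} ev-zero
predRec-correct (suc n) = rec-suc {u = 0} {y = n} (predRec-correct n) (ev-comp (snd-pair 0 _) (fst-pair n _))

predCode : Code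
predCode = compC predRec (pairC zeroC idC)

predCode-correct : ∀ n → Eval predCode n (pred n)
predCode-correct n = ev-comp (ev-pair ev-zero ev-id) (predRec-correct n)

compile : Expr → Code
compileCases : List Expr → Expr → Code

compile `input                = idC
compile (`fst e)              = compC fstC (compile e)
compile (`snd e)              = compC sndC (compile e)
compile (`suc e)              = compC succC (compile e)
compile (`pred e)             = compC predCode (compile e)
compile `⟨ e , e′ ⟩           = pairC (compile e) (compile e′)
compile (`lit n)              = constC n
compile (`case e of bs else d) = compC (compileCases bs d) (pairC idC (compile e))

compileCases []       d = compC (compile d) fstC
compileCases (b ∷ bs) d = recC (compile b) (compC (compileCases bs d) (pairC fstC (compC fstC sndC)))

compile-correct : ∀ e t → Eval (compile e) ⌊ t ⌋ ⌊ ⟦ e ⟧ t ⌋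
compileCases-correct : ∀ bs d t k → Eval (compileCases bs d) (pair ⌊ t ⌋ k) ⌊ select bs d k t ⌋

compile-correct `input       t = ev-id
compile-correct (`fst e)     t = ev-comp (compile-correct e t) (left-correct (⟦ e ⟧ t))
compile-correct (`snd e)     t = ev-comp (compile-correct e t) (right-correct (⟦ e ⟧ t))
compile-correct (`suc e)     t = ev-comp (compile-correct e t) ev-succ
compile-correct (`pred e)    t = ev-comp (compile-correct e t) (predCode-correct _)
compile-correct `⟨ e , e′ ⟩  t = ev-pair (compile-correct e t) (compile-correct e′ t)
compile-correct (`lit n)     t = constC-eval n _
compile-correct (`case e of bs else d) t =
  ev-comp (ev-pair ev-id (compile-correct e t)) (compileCases-correct bs d t ⌊ ⟦ e ⟧ t ⌋)

compileCases-correct []       d t k       = ev-comp (fst-pair ⌊ t ⌋ k) (compile-correct d t)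
compileCases-correct (b ∷ bs) d t zero    = rec-zero {u = ⌊ t ⌋} (compile-correct b t)
compileCases-correct (b ∷ bs) d t (suc k) =
  rec-suc {u = ⌊ t ⌋} {y = k} (compileCases-correct (b ∷ bs) d t k)
    (ev-comp (ev-pair (fst-pair ⌊ t ⌋ _) (ev-comp (snd-pair ⌊ t ⌋ _) (fst-pair k _)))
             (compileCases-correct bs d t k))

-- An abstract machine for Eval

data Frame : Set where
  pair₁   : Code → ℕ → Frame
  pair₂   : ℕ → Frame
  compose : Code → Frame
  recCase : Code → Code → ℕ → Frame
  recurse : Code → ℕ → ℕ → Frame
  search  : Code → ℕ → ℕ → Frame

Stack : Set
Stack = List Frame

data State : Set where
  eval : Code → ℕ → Stack → State
  ret  : ℕ → Stack → State

-- Branching happens only on returned values, never on a projection π₂ x of an argument, so that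
-- the encoding of step as an expression agrees with it definitionally on every state.
step : State → State
step (eval zeroC       x K)               = ret 0 K
step (eval succC       x K)               = ret (suc x) K
step (eval idC         x K)               = ret x K
step (eval fstC        x K)               = ret (π₁ x) K
step (eval sndC        x K)               = ret (π₂ x) K
step (eval (pairC f g) x K)               = eval f x (pair₁ g x ∷ K)
step (eval (compC f g) x K)               = eval g x (compose f ∷ K)
step (eval (recC f g)  x K)               = ret (π₂ x) (recCase f g (π₁ x) ∷ K)
step (eval (muC f)     x K)               = eval f (pair x 0) (search f x 0 ∷ K)
step (ret v [])                           = ret v []
step (ret v (pair₁ g x ∷ K))              = eval g x (pair₂ v ∷ K)
step (ret v (pair₂ a ∷ K))                = ret (pair a v) K
step (ret v (compose f ∷ K))              = eval f v K
step (ret zero    (recCase f g u ∷ K))    = eval f u K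
step (ret (suc y) (recCase f g u ∷ K))    = eval (recC f g) (pair u y) (recurse g u y ∷ K)
step (ret v (recurse g u y ∷ K))          = eval g (pair u (pair y v)) K
step (ret zero    (search f x k ∷ K))     = ret k K
step (ret (suc _) (search f x k ∷ K))     = eval f (pair x (suc k)) (search f x (suc k) ∷ K)

run : ℕ → State → State
run n s = fold s step n

_↠_ : State → State → Set
s ↠ s′ = ∃ λ n → run n s ≡ s′

↠-refl : ∀ {s} → s ↠ s
↠-refl = 0 , refl

↠-trans : ∀ {s s′ s″} → s ↠ s′ → s′ ↠ s″ → s ↠ s″
↠-trans {s} (n , p) (m , q) = m + n , trans (fold-+ s step m) (trans (cong (run m) p) q)

via-step : ∀ {s s′ s″} → step s ≡ s′ → s′ ↠ s″ → s ↠ s″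
via-step {s} refl (n , p) = n + 1 , trans (fold-+ s step n) p

step-rec : ∀ f g u y K → step (eval (recC f g) (pair u y) K) ≡ ret y (recCase f g u ∷ K)
step-rec f g u y K =
  cong₂ (λ u′ y′ → ret y′ (recCase f g u′ ∷ K)) (proj₁ (π-pair u y)) (proj₂ (π-pair u y))

eval-↠ : ∀ {c x y} → Eval c x y → ∀ K → eval c x K ↠ ret y K
search-↠ : ∀ {f x y} → (∀ k → k < y → ∃ λ v → Eval f (pair x k) (suc v)) →
           Eval f (pair x y) 0 →
           ∀ K j d → j + d ≡ y → eval f (pair x j) (search f x j ∷ K) ↠ ret y K

eval-↠ ev-zero K = via-step refl ↠-refl
eval-↠ ev-succ K = via-step refl ↠-refl
eval-↠ ev-id   K = via-step refl ↠-refl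
eval-↠ (ev-fst {a = a} {b} refl) K = via-step (cong (λ v → ret v K) (proj₁ (π-pair a b))) ↠-refl
eval-↠ (ev-snd {a = a} {b} refl) K = via-step (cong (λ v → ret v K) (proj₂ (π-pair a b))) ↠-refl
eval-↠ (ev-pair {g = g} {x} {a} f⇓a g⇓b) K =
  via-step refl (↠-trans (eval-↠ f⇓a (pair₁ g x ∷ K))
    (via-step refl (↠-trans (eval-↠ g⇓b (pair₂ a ∷ K)) (via-step refl ↠-refl))))
eval-↠ (ev-comp {f} g⇓y f⇓z) K =
  via-step refl (↠-trans (eval-↠ g⇓y (compose f ∷ K)) (via-step refl (eval-↠ f⇓z K)))
eval-↠ (ev-rec0 {f} {g} {u = u} refl f⇓z) K =
  via-step (step-rec f g u 0 K) (via-step refl (eval-↠ f⇓z K))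
eval-↠ (ev-recS {f} {g} {u = u} {y} refl h⇓w g⇓z) K =
  via-step (step-rec f g u (suc y) K) (via-step refl
    (↠-trans (eval-↠ h⇓w (recurse g u y ∷ K)) (via-step refl (eval-↠ g⇓z K))))
eval-↠ (ev-mu {y = y} nonzero-below zero-at) K = via-step refl (search-↠ nonzero-below zero-at K 0 y refl)

search-↠ {f} {x} {y} nonzero-below zero-at K j zero refl rewrite +-identityʳ j =
  ↠-trans (eval-↠ zero-at (search f x j ∷ K)) (via-step refl ↠-refl)
search-↠ {f} {x} nonzero-below zero-at K j (suc d) refl =
  ↠-trans (eval-↠ (proj₂ (nonzero-below j j<y)) (search f x j ∷ K))
    (via-step refl (search-↠ nonzero-below zero-at K (suc j) d (sym (+-suc j d))))
  where
  j<y : j < j + suc d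
  j<y = m<m+n j (s≤s z≤n)

Final : State → Set
Final (ret _ []) = ⊤
Final _          = ⊥

final? : Decidable Final
final? (eval _ _ _)    = no λ ()
final? (ret _ [])      = yes tt
final? (ret _ (_ ∷ _)) = no λ ()

final-ret : ∀ s → Final s → ∃ λ v → s ≡ ret v []
final-ret (ret v []) _ = v , refl

run-ret : ∀ k v → run k (ret v []) ≡ ret v []
run-ret zero    v = refl
run-ret (suc k) v = cong step (run-ret k v)

run-stays : ∀ {s n n′ v} → run n s ≡ ret v [] → n ≤ n′ → run n′ s ≡ ret v []
run-stays {s} {n} {n′} {v} halted n≤n′ = begin
  run n′ s                  ≡⟨ cong (λ m → run m s) (sym (m∸n+n≡m n≤n′)) ⟩
  run (n′ ∸ n + n) s        ≡⟨ fold-+ s step (n′ ∸ n) ⟩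
  run (n′ ∸ n) (run n s)    ≡⟨ cong (run (n′ ∸ n)) halted ⟩
  run (n′ ∸ n) (ret v [])   ≡⟨ run-ret (n′ ∸ n) v ⟩
  ret v []                  ∎
  where open ≡-Reasoning

ret-injective : ∀ {v v′ K} → ret v K ≡ ret v′ K → v ≡ v′
ret-injective refl = refl

↠-ret-unique : ∀ {s v v′} → s ↠ ret v [] → s ↠ ret v′ [] → v ≡ v′
↠-ret-unique (n , p) (n′ , p′) with ≤-total n n′
... | inj₁ n≤n′ = ret-injective (trans (sym (run-stays p n≤n′)) p′)
... | inj₂ n′≤n = ret-injective (trans (sym p) (run-stays p′ n′≤n))

Least : ∀ {p} → Pred ℕ p → Set p
Least P = ∃ λ k → P k × (∀ j → j < k → ¬ P j)

least : ∀ {p} {P : Pred ℕ p} → Decidable P → ∀ n → P n → Least P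
least {P = P} P? = <-rec _ λ n smaller Pn → go n smaller Pn (anyUpTo? P? n)
  where
  go : ∀ n → (∀ {m} → m < n → P m → Least P) → P n → Dec (∃ λ m → m < n × P m) → Least P
  go n smaller Pn (yes (m , m<n , Pm)) = smaller m<n Pm
  go n smaller Pn (no none)            = n , Pn , λ j j<n Pj → none (j , j<n , Pj)

earliest-ret : ∀ {s v} → s ↠ ret v [] →
               ∃ λ k → run k s ≡ ret v [] × (∀ j → j < k → ¬ Final (run j s))
earliest-ret {s} {v} (n , halted) with least (λ j → final? (run j s)) n (subst Final (sym halted) tt)
... | k , final-k , not-before with final-ret (run k s) final-k
... | w , run-k = k , subst (λ u → run k s ≡ ret u []) w≡v run-k , not-before
  where
  w≡v : w ≡ v
  w≡v = ↠-ret-unique (k , run-k) (n , halted)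

-- A universal code

codeTree : Code → Tree
codeTree zeroC       = node (leaf 0) (leaf 0)
codeTree succC       = node (leaf 1) (leaf 0)
codeTree idC         = node (leaf 2) (leaf 0)
codeTree fstC        = node (leaf 3) (leaf 0)
codeTree sndC        = node (leaf 4) (leaf 0)
codeTree (pairC f g) = node (leaf 5) (node (codeTree f) (codeTree g))
codeTree (compC f g) = node (leaf 6) (node (codeTree f) (codeTree g))
codeTree (recC f g)  = node (leaf 7) (node (codeTree f) (codeTree g))
codeTree (muC f)     = node (leaf 8) (codeTree f)

⌊codeTree⌋ : ∀ c → ⌊ codeTree c ⌋ ≡ encode c
⌊codeTree⌋ zeroC       = refl
⌊codeTree⌋ succC       = refl
⌊codeTree⌋ idC         = refl
⌊codeTree⌋ fstC        = refl
⌊codeTree⌋ sndC        = refl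
⌊codeTree⌋ (pairC f g) = cong₂ (λ m n → pair 5 (pair m n)) (⌊codeTree⌋ f) (⌊codeTree⌋ g)
⌊codeTree⌋ (compC f g) = cong₂ (λ m n → pair 6 (pair m n)) (⌊codeTree⌋ f) (⌊codeTree⌋ g)
⌊codeTree⌋ (recC f g)  = cong₂ (λ m n → pair 7 (pair m n)) (⌊codeTree⌋ f) (⌊codeTree⌋ g)
⌊codeTree⌋ (muC f)     = cong (pair 8) (⌊codeTree⌋ f)

frameTree : Frame → Tree
frameTree (pair₁ g x)     = node (leaf 0) (node (codeTree g) (leaf x))
frameTree (pair₂ a)       = node (leaf 1) (leaf a)
frameTree (compose f)     = node (leaf 2) (codeTree f)
frameTree (recCase f g u) = node (leaf 3) (node (codeTree f) (node (codeTree g) (leaf u)))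
frameTree (recurse g u y) = node (leaf 4) (node (codeTree g) (node (leaf u) (leaf y)))
frameTree (search f x k)  = node (leaf 5) (node (codeTree f) (node (leaf x) (leaf k)))

stackTree : Stack → Tree
stackTree []      = node (leaf 0) (leaf 0)
stackTree (F ∷ K) = node (leaf 1) (node (frameTree F) (stackTree K))

stateTree : State → Tree
stateTree (eval c x K) = node (leaf 0) (node (codeTree c) (node (leaf x) (stackTree K)))
stateTree (ret v K)    = node (leaf 1) (node (leaf v) (stackTree K))

`eval : Expr → Expr → Expr → Expr
`eval c x K = `⟨ `lit 0 , `⟨ c , `⟨ x , K ⟩ ⟩ ⟩

`ret : Expr → Expr → Expr
`ret v K = `⟨ `lit 1 , `⟨ v , K ⟩ ⟩

`push : Expr → Expr → Expr
`push F K = `⟨ `lit 1 , `⟨ F , K ⟩ ⟩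

-- The branches below are indexed by the tags of codeTree and frameTree.
evalStepExpr : Expr
evalStepExpr = `case `fst c of
    ( `ret (`lit 0) K
    ∷ `ret (`suc x) K
    ∷ `ret x K
    ∷ `ret (`fst x) K
    ∷ `ret (`snd x) K
    ∷ `eval f x (`push `⟨ `lit 0 , `⟨ g , x ⟩ ⟩ K)
    ∷ `eval g x (`push `⟨ `lit 2 , f ⟩ K)
    ∷ `ret (`snd x) (`push `⟨ `lit 3 , `⟨ f , `⟨ g , `fst x ⟩ ⟩ ⟩ K)
    ∷ `eval args `⟨ x , `lit 0 ⟩ (`push `⟨ `lit 5 , `⟨ args , `⟨ x , `lit 0 ⟩ ⟩ ⟩ K)
    ∷ [])
  else `input
  where
  c x K args f g : Expr
  c    = `fst (`snd `input)
  x    = `fst (`snd (`snd `input))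
  K    = `snd (`snd (`snd `input))
  args = `snd c
  f    = `fst args
  g    = `snd args

retStepExpr : Expr
retStepExpr = `case `fst K of (`input ∷ [])
  else `case `fst F of
    ( `eval (`fst D) (`snd D) (`push `⟨ `lit 1 , v ⟩ K′)
    ∷ `ret `⟨ D , v ⟩ K′
    ∷ `eval D v K′
    ∷ `case v of (`eval f u K′ ∷ [])
        else `eval `⟨ `lit 7 , `⟨ f , g ⟩ ⟩ `⟨ u , `pred v ⟩
               (`push `⟨ `lit 4 , `⟨ g , `⟨ u , `pred v ⟩ ⟩ ⟩ K′)
    ∷ `eval (`fst D) `⟨ `fst (`snd D) , `⟨ `snd (`snd D) , v ⟩ ⟩ K′
    ∷ `case v of (`ret k K′ ∷ [])
        else `eval f `⟨ x , `suc k ⟩ (`push `⟨ `lit 5 , `⟨ f , `⟨ x , `suc k ⟩ ⟩ ⟩ K′)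
    ∷ [])
  else `input
  where
  v K F K′ D f g u x k : Expr
  v  = `fst (`snd `input)
  K  = `snd (`snd `input)
  F  = `fst (`snd K)
  K′ = `snd (`snd K)
  D  = `snd F
  f  = `fst D
  g  = `fst (`snd D)
  u  = `snd (`snd D)
  x  = `fst (`snd D)
  k  = `snd (`snd D)

stepExpr : Expr
stepExpr = `case `fst `input of (evalStepExpr ∷ retStepExpr ∷ []) else `input

stepExpr-correct : ∀ s → ⌊ ⟦ stepExpr ⟧ (stateTree s) ⌋ ≡ ⌊ stateTree (step s) ⌋
stepExpr-correct (eval zeroC       x K)               = refl
stepExpr-correct (eval succC       x K)               = refl
stepExpr-correct (eval idC         x K)               = refl
stepExpr-correct (eval fstC        x K)               = refl
stepExpr-correct (eval sndC        x K)               = refl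
stepExpr-correct (eval (pairC f g) x K)               = refl
stepExpr-correct (eval (compC f g) x K)               = refl
stepExpr-correct (eval (recC f g)  x K)               = refl
stepExpr-correct (eval (muC f)     x K)               = refl
stepExpr-correct (ret v [])                           = refl
stepExpr-correct (ret v (pair₁ g x ∷ K))              = refl
stepExpr-correct (ret v (pair₂ a ∷ K))                = refl
stepExpr-correct (ret v (compose f ∷ K))              = refl
stepExpr-correct (ret zero    (recCase f g u ∷ K))    = refl
stepExpr-correct (ret (suc y) (recCase f g u ∷ K))    = refl
stepExpr-correct (ret v (recurse g u y ∷ K))          = refl
stepExpr-correct (ret zero    (search f x k ∷ K))     = refl
stepExpr-correct (ret (suc _) (search f x k ∷ K))     = refl

finalExpr : Expr
finalExpr = `case `fst `input of
    ( `lit 1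
    ∷ `case `fst (`snd (`snd `input)) of (`lit 0 ∷ []) else `lit 1
    ∷ [])
  else `lit 1

finalExpr-nonfinal : ∀ s → ¬ Final s → ⌊ ⟦ finalExpr ⟧ (stateTree s) ⌋ ≡ 1
finalExpr-nonfinal (eval _ _ _)    _         = refl
finalExpr-nonfinal (ret _ [])      not-final = contradiction tt not-final
finalExpr-nonfinal (ret _ (_ ∷ _)) _         = refl

stepCode finalCode : Code
stepCode  = compile stepExpr
finalCode = compile finalExpr

stepCode-correct : ∀ s → Eval stepCode ⌊ stateTree s ⌋ ⌊ stateTree (step s) ⌋
stepCode-correct s = subst (Eval stepCode _) (stepExpr-correct s) (compile-correct stepExpr (stateTree s))

finalCode-final : ∀ v → Eval finalCode ⌊ stateTree (ret v []) ⌋ 0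
finalCode-final v = compile-correct finalExpr (stateTree (ret v []))

finalCode-nonfinal : ∀ s → ¬ Final s → Eval finalCode ⌊ stateTree s ⌋ 1
finalCode-nonfinal s not-final =
  subst (Eval finalCode _) (finalExpr-nonfinal s not-final) (compile-correct finalExpr (stateTree s))

runCode : Code
runCode = recC idC (compC stepCode (compC sndC sndC))

runCode-correct : ∀ s k → Eval runCode (pair ⌊ stateTree s ⌋ k) ⌊ stateTree (run k s) ⌋
runCode-correct s zero    = rec-zero {u = ⌊ stateTree s ⌋} ev-id
runCode-correct s (suc k) = rec-suc {u = ⌊ stateTree s ⌋} {y = k} (runCode-correct s k)
  (ev-comp (ev-comp (snd-pair ⌊ stateTree s ⌋ _) (snd-pair k _)) (stepCode-correct (run k s)))

initExpr outputExpr : Expr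
initExpr   = `eval (`fst `input) (`snd `input) `⟨ `lit 0 , `lit 0 ⟩
outputExpr = `fst (`snd `input)

haltingTime : Code
haltingTime = muC (compC finalCode runCode)

haltingTime-correct : ∀ {s k v} → run k s ≡ ret v [] → (∀ j → j < k → ¬ Final (run j s)) →
                      Eval haltingTime ⌊ stateTree s ⌋ k
haltingTime-correct {s} {k} {v} run-k not-before = ev-mu
  (λ j j<k → 0 , ev-comp (runCode-correct s j) (finalCode-nonfinal (run j s) (not-before j j<k)))
  (ev-comp (runCode-correct s k)
           (subst (λ st → Eval finalCode ⌊ stateTree st ⌋ 0) (sym run-k) (finalCode-final v)))

universal : Code
universal = compC (compile outputExpr) (compC runCode (compC (pairC idC haltingTime) (compile initExpr)))

universal-correct : ∀ {c x y} → Eval c x y → Eval universal (pair (encode c) x) y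
universal-correct {c} {x} {y} c⇓y with earliest-ret (eval-↠ c⇓y [])
... | k , run-k , not-before = subst (λ e → Eval universal (pair e x) y) (⌊codeTree⌋ c)
  (ev-comp (ev-comp (ev-comp start (ev-pair ev-id (haltingTime-correct run-k not-before))) finish)
           (compile-correct outputExpr (stateTree (ret y []))))
  where
  s : State
  s = eval c x []
  start : Eval (compile initExpr) (pair ⌊ codeTree c ⌋ x) ⌊ stateTree s ⌋
  start = compile-correct initExpr (node (codeTree c) (leaf x))
  finish : Eval runCode (pair ⌊ stateTree s ⌋ k) ⌊ stateTree (ret y []) ⌋
  finish = subst (λ st → Eval runCode (pair ⌊ stateTree s ⌋ k) ⌊ stateTree st ⌋) run-k
                 (runCode-correct s k)

Eval-deterministic : ∀ {c x y y′} → Eval c x y → Eval c x y′ → y ≡ y′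
Eval-deterministic c⇓y c⇓y′ = ↠-ret-unique (eval-↠ c⇓y []) (eval-↠ c⇓y′ [])

·-universal : ∀ {e x y} → e · x ≃ y → Eval universal (pair e x) y
·-universal (c , refl , c⇓y) = universal-correct c⇓y

·-deterministic : ∀ {e x y y′} → e · x ≃ y → e · x ≃ y′ → y ≡ y′
·-deterministic e·x≃y e·x≃y′ = Eval-deterministic (·-universal e·x≃y) (·-universal e·x≃y′)

-- Maps from a uniform presheaf into a PER-valued one

module _ (C : IntCat) where
  open IntCat C

  homRealizer : ∀ {d c} (f : ∣ Hom d c ∣) → Σ ℕ (HomReal EOb Hom d c f)
  homRealizer {d} {c} f =
    let (nd , nd∈d) = EOb-inh d ; (nc , nc∈c) = EOb-inh c ; (m , m∈f) = E-inh (Hom d c) f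
    in pair (pair nd nc) m , nd , nc , m , refl , nd∈d , nc∈c , m∈f

  module _ (A : PSh C) (X : PERFunctor C) where
    open PERFunctor X
    open ExpEl using (fun; nat; realizer) renaming (cong to fun-cong)

    private
      X̂ : PSh C
      X̂ = asPSh C X

      X-setoid : Ob → Setoid 0ℓ 0ℓ
      X-setoid d = record { isEquivalence = isEquiv (Fib X̂ d) }

      X-refl : ∀ {d} (x : ∣ Fib X̂ d ∣) → _≈_ (Fib X̂ d) x x
      X-refl {d} x = IsEquivalence.refl (isEquiv (Fib X̂ d)) {x}

      A-refl : ∀ {d} {a : ∣ Fib A d ∣} → _≈_ (Fib A d) a a
      A-refl {d} = IsEquivalence.refl (isEquiv (Fib A d))

    uniform⇒constant : UniformPSh C A →
                       ∀ {c d} (s : ExpEl C A X̂ c) (f : ∣ Hom d c ∣) (a a′ : ∣ Fib A d ∣) →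
                       _≈_ (Fib X̂ d) (fun s f a) (fun s f a′)
    uniform⇒constant uniform {d = d} s f a a′ =
      let (n , n∈A) = uniform d ; (r , r∈f) = homRealizer f ; (e , e-tracks) = realizer s
          (m , e·rn≃m , m∈sa) = e-tracks f a r n r∈f (n∈A a)
          (m′ , e·rn≃m′ , m′∈sa′) = e-tracks f a′ r n r∈f (n∈A a′)
          m≡m′ = ·-deterministic e·rn≃m e·rn≃m′
      in R-tr (X₀ d) m∈sa (R-sym (X₀ d) (subst (R (X₀ d) _) (sym m≡m′) m′∈sa′))

    module _ (uniform : UniformPSh C A) where

      tracks-trunc : ∀ {c} (s : ExpEl C A X̂ c) {e} →
                     Tracks C A X̂ c (fun s) e → Tracks C (Trunc C A) X̂ c (fun s) e
      tracks-trunc s e-tracks f a r t r∈f (a′ , t∈a′) =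
        let (m , e·rt≃m , m∈sa′) = e-tracks f a′ r t r∈f t∈a′
        in m , e·rt≃m , R-tr (X₀ _) (uniform⇒constant uniform s f a a′) m∈sa′

      factor-trunc : ∀ c → ExpEl C A X̂ c → ExpEl C (Trunc C A) X̂ c
      factor-trunc c s = record
        { fun      = fun s
        ; cong     = λ {_} {_} {f′} {a} {a′} f≈f′ _ →
                       R-tr (X₀ _) (fun-cong s f≈f′ A-refl) (uniform⇒constant uniform s f′ a a′)
        ; nat      = nat s
        ; realizer = proj₁ (realizer s) , tracks-trunc s (proj₂ (realizer s))
        }

      precomposition-iso : IsIso C (Exp C (Trunc C A) X̂) (Exp C A X̂) (istar C A X̂)
      precomposition-iso =
          factor-trunc
        , (λ c s≈s′ → s≈s′)
        , (idC , λ { c s t (n , m , t≡ , n∈c , m-tracks) →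
                       t , ev-id , n , m , t≡ , n∈c , tracks-trunc s m-tracks })
        , (λ c s f a → X-refl (fun s f a))
        , (λ c s f a → X-refl (fun s f a))

      module _ (well-supported : WellSupported C A) where
        private
          pointCode idCode : Code
          pointCode = proj₁ well-supported
          idCode    = proj₁ idm-tr

        point : ∀ c → ∣ Fib A c ∣
        point c = let (n , n∈c) = EOb-inh c in proj₁ (proj₂ well-supported c n n∈c)

        evalAtPoint : ∀ c → ExpEl C A X̂ c → ∣ Fib X̂ c ∣
        evalAtPoint c s = fun s (idm c) (point c)

        -- ⟨n, m⟩ ↦ ⟨n, m·⟨id realizer from n, point realizer from n⟩⟩
        evalAtPointCode : Code
        evalAtPointCode =
          pairC fstC (compC universal (pairC sndC (pairC (compC idCode fstC) (compC pointCode fstC))))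

        evalAtPoint-tracked : ∀ c (s : ExpEl C A X̂ c) t → TotReal EOb (Exp C A X̂) c s t →
                              ∃ λ m → Eval evalAtPointCode t m × TotReal EOb (Fib X̂) c (evalAtPoint c s) m
        evalAtPoint-tracked c s .(pair n m) (n , m , refl , n∈c , m-tracks)
          with proj₂ idm-tr c n n∈c | proj₂ well-supported c n n∈c
        ... | r , idCode⇓r , r∈id | a , k , pointCode⇓k , k∈a with m-tracks (idm c) a r k r∈id k∈a
        ... | v , m·rk≃v , v∈sa =
          pair n v ,
          ev-pair (fst-pair n m)
            (ev-comp (ev-pair (snd-pair n m)
                              (ev-pair (ev-comp (fst-pair n m) idCode⇓r) (ev-comp (fst-pair n m) pointCode⇓k)))
                     (·-universal m·rk≃v)) ,
          n , v , refl , n∈c , R-tr (X₀ c) (uniform⇒constant uniform s (idm c) (point c) a) v∈sa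

        evalAtPoint-const : ∀ c (s : ExpEl C A X̂ c) {d} (f : ∣ Hom d c ∣) (a : ∣ Fib A d ∣) →
                            _≈_ (Fib X̂ d) (fun (const-exp C A X̂ c (evalAtPoint c s)) f a) (fun s f a)
        evalAtPoint-const c s {d} f a = begin
          act X-psh f (fun s (idm c) (point c))           ≈⟨ nat s (idm c) f (point c) ⟨
          fun s (idm c ∘ f) (act (isPSh A) f (point c))   ≈⟨ fun-cong s (idˡ f) A-refl ⟩
          fun s f (act (isPSh A) f (point c))             ≈⟨ uniform⇒constant uniform s f _ a ⟩
          fun s f a                                       ∎
          where
          open SetoidReasoning (X-setoid d)
          open PShOn using (act)

        const-iso : IsIso C (Fib X̂) (Exp C A X̂) (const-exp C A X̂)
        const-iso =
            evalAtPoint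
          , (λ c s≈s′ → s≈s′ (idm c) (point c))
          , (evalAtPointCode , evalAtPoint-tracked)
          , (λ c x → PShOn.act-id X-psh x)
          , evalAtPoint-const

proposition5p3 : (C : IntCat) (A : PSh C) (X : PERFunctor C) →
    UniformPSh C A →
    IsIso C (Exp C (Trunc C A) (asPSh C X)) (Exp C A (asPSh C X)) (istar C A (asPSh C X))
    × (WellSupported C A →
    IsIso C (Fib (asPSh C X)) (Exp C A (asPSh C X)) (const-exp C A (asPSh C X)))
proposition5p3 C A X uniform = precomposition-iso C A X uniform , const-iso C A X uniform
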